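{- Let $G=(V,E)$ be a graph, $C$ a vertex cover of the complement $\overline{G}$, and $S=V\setminus C$. Then $$\operatorname{pw}(G)=\min_{L\subseteq C}\max\left\{\operatorname{pw}(G[N[L]];N(L)),\ \operatorname{pw}(G[N[R]];N(R)),\ |S\cup N(L)|-1\right\},$$ where $R=C\setminus N[L]$.
   Context: $\overline{G}$ is the complement of $G$; since $C$ is a vertex cover of $\overline{G}$, the set $S$ is a clique of $G$. For $W\subseteq V$, $N(W)=\bigcup_{v\in W}N(v)\setminus W$ and $N[W]=N(W)\cup W$, neighborhoods taken in $G$; $G[W]$ is the induced subgraph. A path decomposition of a graph $H$ is a sequence of bags $X_1,\dots,X_p$ such that every vertex lies in some bag, every edge has both endpoints in some bag, and the bags containing any vertex are consecutive; its width is $\max_i|X_i|-1$ and $\operatorname{pw}(H)$ is the minimum width. For a graph $H$ and a vertex set $W$ of $H$, $\operatorname{pw}(H;W)$ denotes the minimum width over all path decompositions of $H$ having $W$ as an end bag (first or last bag); by convention $\operatorname{pw}(G[\emptyset];\emptyset)=0$. -}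

module Defs where

open import Data.Nat using (ℕ; zero; suc; _≤_; _∸_; _⊔_)
open import Data.Bool using (Bool; true; false; _∧_; _∨_; not)
open import Data.Fin using (Fin; zero; suc; fromℕ) renaming (_≤_ to _≤F_)
open import Data.Fin.Subset using (Subset; _∈_; _∉_; ∁; _∪_; _∩_; ∣_∣; ⊤; _⊆_)
open import Data.Vec using (tabulate; lookup)
open import Data.Product using (Σ; ∃; ∃-syntax; _×_)
open import Data.Sum using (_⊎_)
open import Relation.Binary.PropositionalEquality using (_≡_; _≢_)
open import Relation.Nullary using (¬_)

record Graph (n : ℕ) : Set where
  field
    adj    : Fin n → Fin n → Bool
    sym    : ∀ u v → adj u v ≡ adj v u
    irrefl : ∀ v → adj v v ≡ false

open Graph public

Adj : ∀ {n} → Graph n → Fin n → Fin n → Set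
Adj G u v = adj G u v ≡ true

CoAdj : ∀ {n} → Graph n → Fin n → Fin n → Set
CoAdj G u v = (u ≢ v) × ¬ Adj G u v

IsVertexCoverCompl : ∀ {n} → Graph n → Subset n → Set
IsVertexCoverCompl G C = ∀ u v → CoAdj G u v → (u ∈ C) ⊎ (v ∈ C)

anyF : ∀ {n} → (Fin n → Bool) → Bool
anyF {zero}  f = false
anyF {suc n} f = f zero ∨ anyF (λ i → f (suc i))

-- open neighbourhood N(W) = (⋃_{w∈W} N(w)) \ W, closed neighbourhood N[W] = N(W) ∪ W
N : ∀ {n} → Graph n → Subset n → Subset n
N G W = tabulate (λ v → not (lookup W v) ∧ anyF (λ u → lookup W u ∧ adj G u v))

N[_,_] : ∀ {n} → Graph n → Subset n → Subset n
N[ G , W ] = N G W ∪ W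

maxF : ∀ {p} → (Fin p → ℕ) → ℕ
maxF {zero}  f = 0
maxF {suc p} f = f zero ⊔ maxF (λ i → f (suc i))

record PathDec {n : ℕ} (G : Graph n) (W : Subset n) : Set where
  field
    len  : ℕ
    bag  : Fin (suc len) → Subset n
    inW  : ∀ i v → v ∈ bag i → v ∈ W
    covV : ∀ v → v ∈ W → ∃[ i ] (v ∈ bag i)
    covE : ∀ u v → u ∈ W → v ∈ W → Adj G u v → ∃[ i ] (u ∈ bag i × v ∈ bag i)
    cons : ∀ i j k v → i ≤F j → j ≤F k → v ∈ bag i → v ∈ bag k → v ∈ bag j

open PathDec public

-- width = max |X_i| - 1 (truncated at 0; cf. convention pw(G[∅];∅) = 0)
width : ∀ {n} {G : Graph n} {W : Subset n} → PathDec G W → ℕ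
width D = maxF (λ i → ∣ bag D i ∣ ∸ 1)

HasEndBag : ∀ {n} {G : Graph n} {W : Subset n} → PathDec G W → Subset n → Set
HasEndBag D B = (bag D zero ≡ B) ⊎ (bag D (fromℕ (len D)) ≡ B)

PwInd : ∀ {n} → Graph n → Subset n → ℕ → Set
PwInd G W k = (∃[ D ] (width {G = G} {W} D ≡ k)) × (∀ (D : PathDec G W) → k ≤ width D)

Pw : ∀ {n} → Graph n → ℕ → Set
Pw G k = PwInd G ⊤ k

PwEnd : ∀ {n} → Graph n → Subset n → Subset n → ℕ → Set
PwEnd G W B k =
  (∃[ D ] (HasEndBag {G = G} {W} D B × width D ≡ k)) ×
  (∀ (D : PathDec G W) → HasEndBag D B → k ≤ width D)

Val : ∀ {n} → Graph n → Subset n → Subset n → ℕ → Set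
Val G C L v =
  let S = ∁ C
      R = C ∩ ∁ N[ G , L ]
  in ∃[ a ] ∃[ b ] (PwEnd G N[ G , L ] (N G L) a × PwEnd G N[ G , R ] (N G R) b
                   × v ≡ a ⊔ b ⊔ (∣ S ∪ N G L ∣ ∸ 1))

MinVal : ∀ {n} → Graph n → Subset n → ℕ → Set
MinVal G C k =
  (∃[ L ] (L ⊆ C × Val G C L k)) ×
  (∀ L v → L ⊆ C → Val G C L v → k ≤ v)

-- Since C covers the complement of G, S = V ∖ C is a clique, so some bag X_j of a path
-- decomposition X_0 … X_l of G contains S.  Let L be the vertices of C occurring only
-- before j; then every vertex of R = C ∖ N[L] occurs at or after j, and N(L), N(R) and
-- S ∪ N(L) all lie in X_j.  Hence X_0 … X_j restricted to N[L], followed by N(L), and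
-- X_l … X_j restricted to N[R], followed by N(R), decompose G[N[L]] and G[N[R]] with the
-- required end bags and no bag larger than before.  Conversely, for any L ⊆ C, a
-- decomposition of G[N[L]] ending in N(L), then the bag S ∪ N(L), then one of G[N[R]]
-- starting with N(R), is a path decomposition of G: L, R and S ∪ N(L) cover V, no edge joins
-- L to R, N[L] meets the rest only in N(L), and N[R] meets S ∪ N(L) only in N(R) ⊆ S ∪ N(L).

module Submission where

open import Defs
open import Data.Bool using (Bool; true; false; _∧_; not)
import Data.Bool.Properties as Bool
open import Data.Empty using (⊥; ⊥-elim)
open import Data.Fin as Fin using (Fin; toℕ; fromℕ)
open import Data.Fin.Properties using (all?; ¬∀⟶∃¬; pigeonhole; toℕ-fromℕ; toℕ≤pred[n])
open import Data.Fin.Subset using (Subset; _∈_; _∉_; ∁; _∪_; _∩_; ∣_∣; ⊤; _⊆_)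
open import Data.Fin.Subset.Properties
  using (_∈?_; _⊆?_; anySubset?; x∈p∪q⁻; x∈p∪q⁺; x∈p∩q⁺; x∈p∩q⁻; x∈∁p⇒x∉p; x∉p⇒x∈∁p; ∈⊤; p⊆q⇒∣p∣≤∣q∣)
open import Data.Nat using (ℕ; zero; suc; _+_; _≤_; _<_; _∸_; _⊔_; z≤n; s≤s; _≤?_; _<?_)
open import Data.Nat.Properties
open import Data.Product using (∃; ∃-syntax; _×_; _,_; proj₁; proj₂)
open import Data.Sum using (_⊎_; inj₁; inj₂; [_,_]′)
open import Data.Vec using (Vec; []; _∷_; tabulate; lookup)
open import Data.Vec.Properties using ([]=⇒lookup; lookup⇒[]=; lookup∘tabulate; ≡-dec)
open import Function using (_∘_)
open import Function.Bundles using (_⇔_; mk⇔)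
open import Relation.Binary.PropositionalEquality using (_≡_; _≢_; refl; trans; cong; cong₂; subst)
import Relation.Binary.PropositionalEquality as ≡
open import Relation.Nullary using (Dec; yes; no; does; ¬_; contradiction)
open import Relation.Binary using (tri<; tri≈; tri>)
open import Relation.Nullary.Decidable using (map′; dec-true; ¬?; _×-dec_; _⊎-dec_; _→-dec_)
open import Relation.Unary using (Decidable)

private
  variable
    n : ℕ

∈-tabulate⁻ : {f : Fin n → Bool} {v : Fin n} → v ∈ tabulate f → f v ≡ true
∈-tabulate⁻ {f = f} {v} v∈ = trans (≡.sym (lookup∘tabulate f v)) ([]=⇒lookup v∈)

∈-tabulate⁺ : {f : Fin n → Bool} {v : Fin n} → f v ≡ true → v ∈ tabulate f
∈-tabulate⁺ {f = f} {v} fv = lookup⇒[]= v _ (trans (lookup∘tabulate f v) fv)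

⟦_⟧ : {P : Fin n → Set} → Decidable P → Subset n
⟦ P? ⟧ = tabulate (does ∘ P?)

∈⟦⟧⁻ : {P : Fin n → Set} (P? : Decidable P) {v : Fin n} → v ∈ ⟦ P? ⟧ → P v
∈⟦⟧⁻ P? {v} v∈ with P? v | ∈-tabulate⁻ v∈
... | yes p | _ = p

∈⟦⟧⁺ : {P : Fin n → Set} (P? : Decidable P) {v : Fin n} → P v → v ∈ ⟦ P? ⟧
∈⟦⟧⁺ P? {v} p = ∈-tabulate⁺ (dec-true (P? v) p)

∧-true⁻ : ∀ {a b} → a ∧ b ≡ true → a ≡ true × b ≡ true
∧-true⁻ {true} {true} _ = refl , refl

not-lookup⁻ : {W : Subset n} {v : Fin n} → not (lookup W v) ≡ true → v ∉ W
not-lookup⁻ p v∈W = contradiction (trans (≡.sym (cong not ([]=⇒lookup v∈W))) p) λ ()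

not-lookup⁺ : {W : Subset n} {v : Fin n} → v ∉ W → not (lookup W v) ≡ true
not-lookup⁺ {W = W} {v} v∉W with lookup W v in eq
... | true  = contradiction (lookup⇒[]= v W eq) v∉W
... | false = refl

anyF-true⁻ : (f : Fin n → Bool) → anyF f ≡ true → ∃[ i ] f i ≡ true
anyF-true⁻ {suc n} f p with f Fin.zero in eq
... | true  = Fin.zero , eq
... | false with i , q ← anyF-true⁻ (f ∘ Fin.suc) p = Fin.suc i , q

anyF-true⁺ : (f : Fin n → Bool) (i : Fin n) → f i ≡ true → anyF f ≡ true
anyF-true⁺ f Fin.zero    p rewrite p = refl
anyF-true⁺ f (Fin.suc i) p rewrite anyF-true⁺ (f ∘ Fin.suc) i p = Bool.∨-zeroʳ (f Fin.zero)

module _ (G : Graph n) where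

  Adj-sym : ∀ {u v} → Adj G u v → Adj G v u
  Adj-sym {u} {v} uv = trans (≡.sym (Graph.sym G u v)) uv

  ∈N⁻ : ∀ {W v} → v ∈ N G W → v ∉ W × ∃[ u ] (u ∈ W × Adj G u v)
  ∈N⁻ {W} {v} v∈
    with v∉ , some ← ∧-true⁻ (∈-tabulate⁻ v∈)
    with u , uv ← anyF-true⁻ (λ u → lookup W u ∧ adj G u v) some
    with u∈ , e ← ∧-true⁻ uv
    = not-lookup⁻ v∉ , u , lookup⇒[]= u W u∈ , e

  ∈N⁺ : ∀ {W u v} → v ∉ W → u ∈ W → Adj G u v → v ∈ N G W
  ∈N⁺ {W} {u} {v} v∉ u∈ uv = ∈-tabulate⁺ (cong₂ _∧_ (not-lookup⁺ v∉)
    (anyF-true⁺ (λ u → lookup W u ∧ adj G u v) u (cong₂ _∧_ ([]=⇒lookup u∈) uv)))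

  ∈N[]⁻ : ∀ {W v} → v ∈ N[ G , W ] → v ∈ N G W ⊎ v ∈ W
  ∈N[]⁻ = x∈p∪q⁻ _ _

  N⊆N[] : ∀ {W} → N G W ⊆ N[ G , W ]
  N⊆N[] v∈ = x∈p∪q⁺ (inj₁ v∈)

  ⊆N[] : ∀ {W} → W ⊆ N[ G , W ]
  ⊆N[] v∈ = x∈p∪q⁺ (inj₂ v∈)

  Adj⇒∈N[] : ∀ {W u v} → u ∈ W → Adj G u v → v ∈ N[ G , W ]
  Adj⇒∈N[] {W} {v = v} u∈ uv with v ∈? W
  ... | yes v∈ = ⊆N[] v∈
  ... | no  v∉ = N⊆N[] (∈N⁺ v∉ u∈ uv)

  Adj⇒both∈N[] : ∀ {W u v} → Adj G u v → u ∈ W ⊎ v ∈ W → u ∈ N[ G , W ] × v ∈ N[ G , W ]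
  Adj⇒both∈N[] uv (inj₁ u∈) = ⊆N[] u∈ , Adj⇒∈N[] u∈ uv
  Adj⇒both∈N[] uv (inj₂ v∈) = Adj⇒∈N[] v∈ (Adj-sym uv) , ⊆N[] v∈

∀≤? : {P : ℕ → Set} → Decidable P → ∀ l → Dec (∀ i → i ≤ l → P i)
∀≤? P? l = map′ (λ all i i≤l → all (s≤s i≤l)) (λ all {i} i<1+l → all i (≤-pred i<1+l))
                (allUpTo? P? (suc l))

∃≤? : {P : ℕ → Set} → Decidable P → ∀ l → Dec (∃[ i ] (i ≤ l × P i))
∃≤? P? l = map′ (λ { (i , s≤s i≤l , p) → i , i≤l , p }) (λ { (i , i≤l , p) → i , s≤s i≤l , p })
                (anyUpTo? P? (suc l))

least : {P : ℕ → Set} → Decidable P → ∀ {m} → P m → ∃[ k ] (P k × (∀ {i} → P i → k ≤ i))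
least {P} P? {m} = below m ≤-refl
  where
    below : ∀ b {j} → j ≤ b → P j → ∃[ k ] (P k × (∀ {i} → P i → k ≤ i))
    below zero    z≤n pj = 0 , pj , λ _ → z≤n
    below (suc b) {j} j≤1+b pj with anyUpTo? P? (suc b)
    ... | yes (i , s≤s i≤b , pi) = below b i≤b pi
    ... | no  none = j , pj , λ {i} pi → ≤-trans j≤1+b (≮⇒≥ λ i<1+b → none (i , i<1+b , pi))

maxF-ub : ∀ {p} (f : Fin p → ℕ) (i : Fin p) → f i ≤ maxF f
maxF-ub f Fin.zero    = m≤m⊔n _ _
maxF-ub f (Fin.suc i) = ≤-trans (maxF-ub (f ∘ Fin.suc) i) (m≤n⊔m _ _)

maxF-lub : ∀ {p w} (f : Fin p → ℕ) → (∀ i → f i ≤ w) → maxF f ≤ w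
maxF-lub {zero}  f _   = z≤n
maxF-lub {suc p} f f≤w = ⊔-lub (f≤w Fin.zero) (maxF-lub (f ∘ Fin.suc) (f≤w ∘ Fin.suc))

maxF-attained : ∀ {p} (f : Fin p → ℕ) → maxF f ≡ 0 ⊎ ∃[ i ] f i ≡ maxF f
maxF-attained {zero}  f = inj₁ refl
maxF-attained {suc p} f with ⊔-sel (f Fin.zero) (maxF (f ∘ Fin.suc))
... | inj₁ eq = inj₂ (Fin.zero , ≡.sym eq)
... | inj₂ eq with maxF-attained (f ∘ Fin.suc)
...   | inj₁ max≡0       = inj₁ (trans eq max≡0)
...   | inj₂ (i , fi≡max) = inj₂ (Fin.suc i , trans fi≡max (≡.sym eq))

clamp : ∀ m → ℕ → Fin (suc m)
clamp m       zero    = Fin.zero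
clamp zero    (suc i) = Fin.zero
clamp (suc m) (suc i) = Fin.suc (clamp m i)

toℕ-clamp : ∀ {m i} → i ≤ m → toℕ (clamp m i) ≡ i
toℕ-clamp {m}     {zero}  _         = refl
toℕ-clamp {suc m} {suc i} (s≤s i≤m) = cong suc (toℕ-clamp i≤m)

clamp-toℕ : ∀ {m} (f : Fin (suc m)) → clamp m (toℕ f) ≡ f
clamp-toℕ {m}     Fin.zero    = refl
clamp-toℕ {suc m} (Fin.suc f) = cong Fin.suc (clamp-toℕ f)

clamp-mono : ∀ m {i j} → i ≤ j → toℕ (clamp m i) ≤ toℕ (clamp m j)
clamp-mono m       {zero}              _         = z≤n
clamp-mono zero    {suc i} {suc j}     _         = z≤n
clamp-mono (suc m) {suc i} {suc j}     (s≤s i≤j) = s≤s (clamp-mono m i≤j)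

clamp-last : ∀ m → clamp m m ≡ fromℕ m
clamp-last zero    = refl
clamp-last (suc m) = cong Fin.suc (clamp-last m)

Convex : ℕ → (ℕ → Subset n) → Set
Convex l X = ∀ i j k → i ≤ j → j ≤ k → k ≤ l → ∀ {v} → v ∈ X i → v ∈ X k → v ∈ X j

-- Bags are indexed by ℕ so that reversal and concatenation are index arithmetic;
-- only X 0, …, X l matter.
record IsPathDec (G : Graph n) (W : Subset n) (l : ℕ) (X : ℕ → Subset n) : Set where
  field
    inside   : ∀ i → i ≤ l → X i ⊆ W
    vertices : ∀ {v} → v ∈ W → ∃[ i ] (i ≤ l × v ∈ X i)
    edges    : ∀ {u v} → u ∈ W → v ∈ W → Adj G u v → ∃[ i ] (i ≤ l × u ∈ X i × v ∈ X i)
    convex   : Convex l X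

open IsPathDec public

WidthAtMost : ℕ → (ℕ → Subset n) → ℕ → Set
WidthAtMost l X w = ∀ i → i ≤ l → ∣ X i ∣ ∸ 1 ≤ w

EndBag : ℕ → (ℕ → Subset n) → Subset n → Set
EndBag l X B = X 0 ≡ B ⊎ X l ≡ B

record Decomposition (G : Graph n) (W : Subset n) (w : ℕ) : Set where
  constructor decomposition
  field
    last        : ℕ
    bags        : ℕ → Subset n
    isPathDec   : IsPathDec G W last bags
    widthAtMost : WidthAtMost last bags w

open Decomposition public

HasEnd : {G : Graph n} {W : Subset n} {w : ℕ} → Decomposition G W w → Subset n → Set
HasEnd D B = EndBag (last D) (bags D) B

module _ {G : Graph n} {W : Subset n} where

  fromPathDec : (D : PathDec G W) → Decomposition G W (width D)
  fromPathDec D = decomposition (len D) (bag D ∘ clamp (len D)) (record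
    { inside   = λ i _ {v} → inW D (clamp (len D) i) v
    ; vertices = λ {v} v∈ → let f , p = covV D v v∈ in toℕ f , toℕ≤pred[n] f , reindex p
    ; edges    = λ {u} {v} u∈ v∈ uv → let f , p , q = covE D u v u∈ v∈ uv in
                   toℕ f , toℕ≤pred[n] f , reindex p , reindex q
    ; convex   = λ i j k i≤j j≤k _ {v} → cons D _ _ _ v (clamp-mono _ i≤j) (clamp-mono _ j≤k)
    }) (λ i _ → maxF-ub (λ f → ∣ bag D f ∣ ∸ 1) (clamp (len D) i))
    where
      reindex : ∀ {v f} → v ∈ bag D f → v ∈ bag D (clamp (len D) (toℕ f))
      reindex {v} {f} = subst (λ g → v ∈ bag D g) (≡.sym (clamp-toℕ f))

  fromPathDec-end : ∀ {B} (D : PathDec G W) → HasEndBag D B → HasEnd (fromPathDec D) B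
  fromPathDec-end D (inj₁ first≡B) = inj₁ first≡B
  fromPathDec-end D (inj₂ last≡B)  = inj₂ (trans (cong (bag D) (clamp-last (len D))) last≡B)

  toPathDec : ∀ {w} → Decomposition G W w → PathDec G W
  toPathDec (decomposition l X d _) = record
    { len  = l
    ; bag  = X ∘ toℕ
    ; inW  = λ f v → inside d (toℕ f) (toℕ≤pred[n] f)
    ; covV = λ v v∈ → let i , i≤l , p = vertices d v∈ in clamp l i , reindex i≤l p
    ; covE = λ u v u∈ v∈ uv → let i , i≤l , p , q = edges d u∈ v∈ uv in
               clamp l i , reindex i≤l p , reindex i≤l q
    ; cons = λ i j k v i≤j j≤k → convex d (toℕ i) (toℕ j) (toℕ k) i≤j j≤k (toℕ≤pred[n] k)
    }
    where
      reindex : ∀ {v i} → i ≤ l → v ∈ X i → v ∈ X (toℕ (clamp l i))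
      reindex {v} i≤l = subst (λ i → v ∈ X i) (≡.sym (toℕ-clamp i≤l))

  toPathDec-width : ∀ {w} (D : Decomposition G W w) → width (toPathDec D) ≤ w
  toPathDec-width D = maxF-lub _ (λ f → widthAtMost D (toℕ f) (toℕ≤pred[n] f))

  toPathDec-end : ∀ {w B} (D : Decomposition G W w) → HasEnd D B → HasEndBag (toPathDec D) B
  toPathDec-end D (inj₁ first≡B) = inj₁ first≡B
  toPathDec-end D (inj₂ last≡B)  = inj₂ (trans (cong (bags D) (toℕ-fromℕ (last D))) last≡B)

-- Operations on path decompositions

module _ {G : Graph n} {W : Subset n} where

  IsPathDec-cong : ∀ {l X Y} → (∀ i → i ≤ l → X i ≡ Y i) → IsPathDec G W l X → IsPathDec G W l Y
  IsPathDec-cong {l} {X} {Y} X≗Y d = record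
    { inside   = λ i i≤l → inside d i i≤l ∘ from i≤l
    ; vertices = λ v∈ → let i , i≤l , p = vertices d v∈ in i , i≤l , to i≤l p
    ; edges    = λ u∈ v∈ uv → let i , i≤l , p , q = edges d u∈ v∈ uv in i , i≤l , to i≤l p , to i≤l q
    ; convex   = λ i j k i≤j j≤k k≤l p q →
        to (≤-trans j≤k k≤l) (convex d i j k i≤j j≤k k≤l
          (from (≤-trans i≤j (≤-trans j≤k k≤l)) p) (from k≤l q))
    }
    where
      to : ∀ {i v} → i ≤ l → v ∈ X i → v ∈ Y i
      to {i} {v} i≤l = subst (v ∈_) (X≗Y i i≤l)
      from : ∀ {i v} → i ≤ l → v ∈ Y i → v ∈ X i
      from {i} {v} i≤l = subst (v ∈_) (≡.sym (X≗Y i i≤l))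

  IsPathDec-resp-⊆ : ∀ {W′ l X} → W ⊆ W′ → W′ ⊆ W → IsPathDec G W l X → IsPathDec G W′ l X
  IsPathDec-resp-⊆ W⊆W′ W′⊆W d = record
    { inside   = λ i i≤l → W⊆W′ ∘ inside d i i≤l
    ; vertices = vertices d ∘ W′⊆W
    ; edges    = λ u∈ v∈ → edges d (W′⊆W u∈) (W′⊆W v∈)
    ; convex   = convex d
    }

single-isPathDec : {G : Graph n} {B : Subset n} → IsPathDec G B 0 (λ _ → B)
single-isPathDec = record
  { inside   = λ _ _ p → p
  ; vertices = λ v∈ → 0 , z≤n , v∈
  ; edges    = λ u∈ v∈ _ → 0 , z≤n , u∈ , v∈
  ; convex   = λ _ _ _ _ _ _ p _ → p
  }

reverseBags : ℕ → (ℕ → Subset n) → ℕ → Subset n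
reverseBags l X i = X (l ∸ i)

reverse-isPathDec : {G : Graph n} {W : Subset n} {l : ℕ} {X : ℕ → Subset n} →
                    IsPathDec G W l X → IsPathDec G W l (reverseBags l X)
reverse-isPathDec {l = l} {X} d = record
  { inside   = λ i _ → inside d (l ∸ i) (m∸n≤m l i)
  ; vertices = λ v∈ → let i , i≤l , p = vertices d v∈ in l ∸ i , m∸n≤m l i , back i≤l p
  ; edges    = λ u∈ v∈ uv → let i , i≤l , p , q = edges d u∈ v∈ uv in
                 l ∸ i , m∸n≤m l i , back i≤l p , back i≤l q
  ; convex   = λ i j k i≤j j≤k _ p q →
      convex d (l ∸ k) (l ∸ j) (l ∸ i) (∸-monoʳ-≤ l j≤k) (∸-monoʳ-≤ l i≤j) (m∸n≤m l i) q p
  }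
  where
    back : ∀ {i v} → i ≤ l → v ∈ X i → v ∈ X (l ∸ (l ∸ i))
    back {v = v} i≤l = subst (λ i → v ∈ X i) (≡.sym (m∸[m∸n]≡n i≤l))

reverse : {G : Graph n} {W : Subset n} {w : ℕ} → Decomposition G W w → Decomposition G W w
reverse (decomposition l X d X≤w) =
  decomposition l (reverseBags l X) (reverse-isPathDec d) (λ i _ → X≤w (l ∸ i) (m∸n≤m l i))

module _ {G : Graph n} {W : Subset n} {w : ℕ} {B : Subset n} where

  endingWith : (D : Decomposition G W w) → HasEnd D B → ∃[ D′ ] bags D′ (last D′) ≡ B
  endingWith D (inj₂ last≡B)  = D , last≡B
  endingWith D (inj₁ first≡B) = reverse D , trans (cong (bags D) (n∸n≡0 (last D))) first≡B

  startingWith : (D : Decomposition G W w) → HasEnd D B → ∃[ D′ ] bags D′ 0 ≡ B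
  startingWith D (inj₁ first≡B) = D , first≡B
  startingWith D (inj₂ last≡B)  = reverse D , last≡B

append : ℕ → (ℕ → Subset n) → (ℕ → Subset n) → ℕ → Subset n
append l X Y i with i ≤? l
... | yes _ = X i
... | no  _ = Y (i ∸ suc l)

module Append (l₁ l₂ : ℕ) (X Y : ℕ → Subset n) where

  append-≤ : ∀ {i} → i ≤ l₁ → append l₁ X Y i ≡ X i
  append-≤ {i} i≤l₁ with i ≤? l₁
  ... | yes _    = refl
  ... | no  i≰l₁ = contradiction i≤l₁ i≰l₁

  append-> : ∀ i → append l₁ X Y (suc l₁ + i) ≡ Y i
  append-> i with suc l₁ + i ≤? l₁
  ... | yes l₁<l₁ = contradiction l₁<l₁ (<⇒≱ (s≤s (m≤m+n l₁ i)))
  ... | no  _     = cong Y (m+n∸m≡n (suc l₁) i)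

  index-cases : ∀ {i} → i ≤ suc (l₁ + l₂) → i ≤ l₁ ⊎ ∃[ i′ ] (i′ ≤ l₂ × i ≡ suc l₁ + i′)
  index-cases {i} i≤ with i ≤? l₁
  ... | yes i≤l₁ = inj₁ i≤l₁
  ... | no  i≰l₁ = inj₂ (i ∸ suc l₁ , ≤-trans (∸-monoˡ-≤ (suc l₁) i≤) (≤-reflexive (m+n∸m≡n (suc l₁) l₂))
                       , ≡.sym (m+[n∸m]≡n (≰⇒> i≰l₁)))

  private
    Z : ℕ → Subset n
    Z = append l₁ X Y

    left : ∀ {i v} → i ≤ l₁ → v ∈ X i → v ∈ Z i
    left {v = v} i≤l₁ = subst (v ∈_) (≡.sym (append-≤ i≤l₁))

    left⁻ : ∀ {i v} → i ≤ l₁ → v ∈ Z i → v ∈ X i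
    left⁻ {v = v} i≤l₁ = subst (v ∈_) (append-≤ i≤l₁)

    right : ∀ {i v} → v ∈ Y i → v ∈ Z (suc l₁ + i)
    right {i} {v} = subst (v ∈_) (≡.sym (append-> i))

    right⁻ : ∀ {i v} → v ∈ Z (suc l₁ + i) → v ∈ Y i
    right⁻ {i} {v} = subst (v ∈_) (append-> i)

    left-≤ : ∀ {i} → i ≤ l₁ → i ≤ suc (l₁ + l₂)
    left-≤ i≤l₁ = ≤-trans i≤l₁ (≤-trans (m≤m+n l₁ l₂) (n≤1+n _))

    right-≤ : ∀ {i} → i ≤ l₂ → suc l₁ + i ≤ suc (l₁ + l₂)
    right-≤ i≤l₂ = s≤s (+-monoʳ-≤ l₁ i≤l₂)

    cancel : ∀ {i j} → suc l₁ + i ≤ suc l₁ + j → i ≤ j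
    cancel = +-cancelˡ-≤ (suc l₁) _ _

  append-convex : Convex l₁ X → Convex l₂ Y →
                  (∀ {a b v} → a ≤ l₁ → b ≤ l₂ → v ∈ X a → v ∈ Y b → v ∈ X l₁ × v ∈ Y 0) →
                  Convex (suc (l₁ + l₂)) Z
  append-convex cX cY seam i j k i≤j j≤k k≤ {v} p q with index-cases k≤
  ... | inj₁ k≤l₁ = left j≤l₁ (cX i j k i≤j j≤k k≤l₁ (left⁻ i≤l₁ p) (left⁻ k≤l₁ q))
    where j≤l₁ = ≤-trans j≤k k≤l₁
          i≤l₁ = ≤-trans i≤j j≤l₁
  ... | inj₂ (k′ , k′≤l₂ , refl) with index-cases (≤-trans j≤k k≤)
  ...   | inj₁ j≤l₁ = left j≤l₁ (cX i j l₁ i≤j j≤l₁ ≤-refl (left⁻ i≤l₁ p)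
                        (proj₁ (seam i≤l₁ k′≤l₂ (left⁻ i≤l₁ p) (right⁻ q))))
    where i≤l₁ = ≤-trans i≤j j≤l₁
  ...   | inj₂ (j′ , _ , refl) with index-cases (≤-trans i≤j (≤-trans j≤k k≤))
  ...     | inj₁ i≤l₁ = right (cY 0 j′ k′ z≤n (cancel j≤k) k′≤l₂
                          (proj₂ (seam i≤l₁ k′≤l₂ (left⁻ i≤l₁ p) (right⁻ q))) (right⁻ q))
  ...     | inj₂ (i′ , _ , refl) = right (cY i′ j′ k′ (cancel i≤j) (cancel j≤k) k′≤l₂ (right⁻ p) (right⁻ q))

  append-isPathDec : {G : Graph n} {W₁ W₂ : Subset n} →
    IsPathDec G W₁ l₁ X → IsPathDec G W₂ l₂ Y →
    (∀ {v} → v ∈ W₁ → v ∈ W₂ → v ∈ X l₁ × v ∈ Y 0) →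
    (∀ {u v} → Adj G u v → u ∈ W₁ ∪ W₂ → v ∈ W₁ ∪ W₂ → (u ∈ W₁ × v ∈ W₁) ⊎ (u ∈ W₂ × v ∈ W₂)) →
    IsPathDec G (W₁ ∪ W₂) (suc (l₁ + l₂)) Z
  append-isPathDec {G} {W₁} {W₂} d₁ d₂ seam split = record
    { inside   = inside′
    ; vertices = λ v∈ → [ vertex₁ , vertex₂ ]′ (x∈p∪q⁻ _ _ v∈)
    ; edges    = λ u∈ v∈ uv → [ edge₁ uv , edge₂ uv ]′ (split uv u∈ v∈)
    ; convex   = append-convex (convex d₁) (convex d₂)
                   λ a≤ b≤ p q → seam (inside d₁ _ a≤ p) (inside d₂ _ b≤ q)
    }
    where
      inside′ : ∀ i → i ≤ suc (l₁ + l₂) → Z i ⊆ W₁ ∪ W₂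
      inside′ i i≤ p with index-cases i≤
      ... | inj₁ i≤l₁              = x∈p∪q⁺ (inj₁ (inside d₁ i i≤l₁ (left⁻ i≤l₁ p)))
      ... | inj₂ (i′ , i′≤ , refl) = x∈p∪q⁺ (inj₂ (inside d₂ i′ i′≤ (right⁻ p)))
      vertex₁ : ∀ {v} → v ∈ W₁ → ∃[ i ] (i ≤ suc (l₁ + l₂) × v ∈ Z i)
      vertex₁ v∈ = let i , i≤ , p = vertices d₁ v∈ in i , left-≤ i≤ , left i≤ p
      vertex₂ : ∀ {v} → v ∈ W₂ → ∃[ i ] (i ≤ suc (l₁ + l₂) × v ∈ Z i)
      vertex₂ v∈ = let i , i≤ , p = vertices d₂ v∈ in suc l₁ + i , right-≤ i≤ , right p
      edge₁ : ∀ {u v} → Adj G u v → u ∈ W₁ × v ∈ W₁ → ∃[ i ] (i ≤ suc (l₁ + l₂) × u ∈ Z i × v ∈ Z i)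
      edge₁ uv (u∈ , v∈) = let i , i≤ , p , q = edges d₁ u∈ v∈ uv in i , left-≤ i≤ , left i≤ p , left i≤ q
      edge₂ : ∀ {u v} → Adj G u v → u ∈ W₂ × v ∈ W₂ → ∃[ i ] (i ≤ suc (l₁ + l₂) × u ∈ Z i × v ∈ Z i)
      edge₂ uv (u∈ , v∈) = let i , i≤ , p , q = edges d₂ u∈ v∈ uv in
                             suc l₁ + i , right-≤ i≤ , right p , right q

  append-width : ∀ {w} → WidthAtMost l₁ X w → WidthAtMost l₂ Y w → WidthAtMost (suc (l₁ + l₂)) Z w
  append-width {w} X≤w Y≤w i i≤ with index-cases i≤
  ... | inj₁ i≤l₁ = subst (λ B → ∣ B ∣ ∸ 1 ≤ w) (≡.sym (append-≤ i≤l₁)) (X≤w i i≤l₁)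
  ... | inj₂ (i′ , i′≤ , refl) = subst (λ B → ∣ B ∣ ∸ 1 ≤ w) (≡.sym (append-> i′)) (Y≤w i′ i′≤)

-- Optimal decompositions exist

skip : ℕ → ℕ → ℕ
skip i k with k <? i
... | yes _ = k
... | no  _ = suc k

skip-< : ∀ {i k} → k < i → skip i k ≡ k
skip-< {i} {k} k<i with k <? i
... | yes _   = refl
... | no  k≮i = contradiction k<i k≮i

skip-≥ : ∀ {i k} → i ≤ k → skip i k ≡ suc k
skip-≥ {i} {k} i≤k with k <? i
... | yes k<i = contradiction i≤k (<⇒≱ k<i)
... | no  _   = refl

skip-≤ : ∀ i k → skip i k ≤ suc k
skip-≤ i k with k <? i
... | yes _ = n≤1+n k
... | no  _ = ≤-refl

skip-mono : ∀ i {a b} → a ≤ b → skip i a ≤ skip i b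
skip-mono i {a} {b} a≤b with a <? i | b <? i
... | yes _   | yes _   = a≤b
... | yes _   | no  _   = m≤n⇒m≤1+n a≤b
... | no  a≮i | yes b<i = contradiction (≤-<-trans a≤b b<i) a≮i
... | no  _   | no  _   = s≤s a≤b

module Drop {m i : ℕ} {X : ℕ → Subset n} (i≤1+m : i ≤ suc m) (Xi⊆ : X i ⊆ X (suc i)) where

  skip-bound : ∀ {k} → k ≤ suc m → skip i k ≤ suc (suc m)
  skip-bound k≤ = ≤-trans (skip-≤ i _) (s≤s k≤)

  survivor : ∀ x → x ≤ suc (suc m) → ∃[ k ] (k ≤ suc m × X x ⊆ X (skip i k))
  survivor x x≤ with <-cmp x i
  survivor x x≤ | tri< x<i _ _ =
    x , ≤-trans (<⇒≤ x<i) i≤1+m , λ {v} → subst (λ k → v ∈ X k) (≡.sym (skip-< x<i))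
  survivor x x≤ | tri≈ _ refl _ =
    i , i≤1+m , λ {v} → subst (λ k → v ∈ X k) (≡.sym (skip-≥ ≤-refl)) ∘ Xi⊆
  survivor (suc k) (s≤s k≤) | tri> _ _ i<1+k =
    k , k≤ , λ {v} → subst (λ k → v ∈ X k) (≡.sym (skip-≥ (≤-pred i<1+k)))

  drop-isPathDec : {G : Graph n} {W : Subset n} →
                   IsPathDec G W (suc (suc m)) X → IsPathDec G W (suc m) (X ∘ skip i)
  drop-isPathDec d = record
    { inside   = λ k k≤ → inside d (skip i k) (skip-bound k≤)
    ; vertices = λ v∈ → let x , x≤ , p = vertices d v∈ ; k , k≤ , X⊆ = survivor x x≤ in k , k≤ , X⊆ p
    ; edges    = λ u∈ v∈ uv → let x , x≤ , p , q = edges d u∈ v∈ uv ; k , k≤ , X⊆ = survivor x x≤ in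
                   k , k≤ , X⊆ p , X⊆ q
    ; convex   = λ a b c a≤b b≤c c≤ →
        convex d (skip i a) (skip i b) (skip i c) (skip-mono i a≤b) (skip-mono i b≤c) (skip-bound c≤)
    }

⊈⇒∃ : {p q : Subset n} → ¬ p ⊆ q → ∃[ v ] (v ∈ p × v ∉ q)
⊈⇒∃ {n} {p} {q} p⊈q
  with v , ¬p⇒q ← ¬∀⟶∃¬ n (λ v → v ∈ p → v ∈ q) (λ v → v ∈? p →-dec v ∈? q) (λ p⇒q → p⊈q (p⇒q _))
  with v ∈? p
... | yes v∈p = v , v∈p , λ v∈q → ¬p⇒q λ _ → v∈q
... | no  v∉p = contradiction (λ v∈p → contradiction v∈p v∉p) ¬p⇒q

-- If each of more than n inner bags lost a vertex to its successor, some vertex would be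
-- lost twice, which convexity forbids.
redundantBag : ∀ {m} {X : ℕ → Subset n} → n ≤ m → Convex (suc (suc m)) X →
               ∃[ i ] (i ≤ suc m × 1 ≤ i × X i ⊆ X (suc i))
redundantBag {n} {m} {X} n≤m cX with ∃≤? (λ i → 1 ≤? i ×-dec X i ⊆? X (suc i)) (suc m)
... | yes found = found
... | no  none = ⊥-elim leavesTwice
  where
    leaver : (t : Fin (suc m)) → ∃[ v ] (v ∈ X (suc (toℕ t)) × v ∉ X (suc (suc (toℕ t))))
    leaver t = ⊈⇒∃ λ X⊆ → none (suc (toℕ t) , s≤s (toℕ≤pred[n] t) , s≤s z≤n , X⊆)

    leavesTwice : ⊥
    leavesTwice with t₁ , t₂ , t₁<t₂ , same ← pigeonhole (s≤s n≤m) (proj₁ ∘ leaver) =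
      let _ , in₁ , out₁ = leaver t₁ ; _ , in₂ , _ = leaver t₂ in
      out₁ (cX (suc (toℕ t₁)) (suc (suc (toℕ t₁))) (suc (toℕ t₂)) (n≤1+n _) (s≤s t₁<t₂)
               (s≤s (≤-trans (toℕ≤pred[n] t₂) (n≤1+n m)))
               in₁ (subst (λ v → v ∈ X (suc (toℕ t₂))) (≡.sym same) in₂))

anyVec? : ∀ {m} {P : Vec (Subset n) m → Set} → Decidable P → Dec (∃ P)
anyVec? {m = zero}  P? = map′ ([] ,_) (λ { ([] , p) → p }) (P? [])
anyVec? {m = suc m} P? =
  map′ (λ { (x , xs , p) → x ∷ xs , p }) (λ { (x ∷ xs , p) → x , xs , p })
       (anySubset? λ x → anyVec? (P? ∘ (x ∷_)))

module Optimal (G : Graph n) (W B : Subset n) where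

  Fits : ℕ → ℕ → (ℕ → Subset n) → Set
  Fits w l X = IsPathDec G W l X × WidthAtMost l X w × EndBag l X B

  fits? : ∀ w l X → Dec (Fits w l X)
  fits? w l X = isPathDec? ×-dec ∀≤? (λ i → ∣ X i ∣ ∸ 1 ≤? w) l ×-dec (X 0 ≟ˢ B ⊎-dec X l ≟ˢ B)
    where
      _≟ˢ_ : (p q : Subset n) → Dec (p ≡ q)
      _≟ˢ_ = ≡-dec Bool._≟_
      isPathDec? : Dec (IsPathDec G W l X)
      isPathDec? = map′
        (λ (a , b , c , d) → record { inside = a ; vertices = b _ ; edges = c _ _ ; convex = d })
        (λ d → inside d , (λ _ → vertices d) , (λ _ _ → edges d) , convex d)
        (∀≤? (λ i → X i ⊆? W) l
          ×-dec all? (λ v → v ∈? W →-dec ∃≤? (λ i → v ∈? X i) l)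
          ×-dec all? (λ u → all? λ v → u ∈? W →-dec v ∈? W →-dec adj G u v Bool.≟ true →-dec
                                          ∃≤? (λ i → u ∈? X i ×-dec v ∈? X i) l)
          ×-dec map′ (λ c i j k i≤j j≤k k≤l → c k k≤l j j≤k i i≤j _)
                     (λ c k k≤l j j≤k i i≤j _ → c i j k i≤j j≤k k≤l)
                     (∀≤? (λ k → ∀≤? (λ j → ∀≤? (λ i → all? λ v →
                        v ∈? X i →-dec v ∈? X k →-dec v ∈? X j) j) k) l))

  Fits-cong : ∀ {w l X Y} → (∀ i → i ≤ l → X i ≡ Y i) → Fits w l X → Fits w l Y
  Fits-cong {w} {l} X≗Y (d , X≤w , e) =
    IsPathDec-cong X≗Y d ,
    (λ i i≤l → subst (λ b → ∣ b ∣ ∸ 1 ≤ w) (X≗Y i i≤l) (X≤w i i≤l)) ,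
    [ (λ p → inj₁ (trans (≡.sym (X≗Y 0 z≤n)) p)) , (λ p → inj₂ (trans (≡.sym (X≗Y l ≤-refl)) p)) ]′ e

  dropRedundant : ∀ {w l X} → n < l → Fits w (suc l) X → ∃[ X′ ] Fits w l X′
  dropRedundant {w} {suc m} {X} (s≤s n≤m) (d , X≤w , e)
    with i , i≤ , 1≤i , Xi⊆ ← redundantBag n≤m (convex d)
    = X ∘ skip i , drop-isPathDec d , (λ k k≤ → X≤w (skip i k) (skip-bound k≤)) ,
      [ inj₁ ∘ trans (cong X (skip-< 1≤i)) , inj₂ ∘ trans (cong X (skip-≥ i≤)) ]′ e
    where open Drop {X = X} i≤ Xi⊆

  shorten : ∀ {w} l X → Fits w l X → ∃[ l′ ] (l′ ≤ suc n × ∃[ X′ ] Fits w l′ X′)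
  shorten zero    X fits = 0 , z≤n , X , fits
  shorten (suc l) X fits with suc l ≤? suc n
  ... | yes short = suc l , short , X , fits
  ... | no  long  = let X′ , fits′ = dropRedundant (≤-pred (≰⇒> long)) fits in shorten l X′ fits′

  -- Existence of a decomposition of width ≤ w with end bag B is decidable: by shortening,
  -- only bag sequences of length at most n + 2 need to be searched.
  decomposition? : ∀ w → Dec (∃[ D ] HasEnd {G = G} {W} {w} D B)
  decomposition? w with ∃≤? (λ l → anyVec? λ xs → fits? w l (lookup xs ∘ clamp l)) (suc n)
  ... | yes (l , _ , xs , d , X≤w , e) = yes (decomposition l _ d X≤w , e)
  ... | no  none = no λ (D , e) →
          let l , l≤ , X , fits = shorten (last D) (bags D) (isPathDec D , widthAtMost D , e) in
          none (l , l≤ , tabulate (X ∘ toℕ) , Fits-cong (tabulated X) fits)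
    where
      tabulated : ∀ {l} (X : ℕ → Subset n) i → i ≤ l → X i ≡ lookup (tabulate (X ∘ toℕ)) (clamp l i)
      tabulated X i i≤l = ≡.sym (trans (lookup∘tabulate (X ∘ toℕ) _) (cong X (toℕ-clamp i≤l)))

  pwEnd-attained : ∀ {w} (D : Decomposition G W w) → HasEnd D B → ∃[ a ] (a ≤ w × PwEnd G W B a)
  pwEnd-attained {w} D e
    with a , (Dₐ , eₐ) , minimal ← least decomposition? (D , e)
    = let optimal : ∀ (D′ : PathDec G W) → HasEndBag D′ B → a ≤ width D′
          optimal D′ e′ = minimal (fromPathDec D′ , fromPathDec-end D′ e′)
      in a , minimal (D , e) ,
         (toPathDec Dₐ , toPathDec-end Dₐ eₐ ,
          ≤-antisym (toPathDec-width Dₐ) (optimal (toPathDec Dₐ) (toPathDec-end Dₐ eₐ))) ,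
         optimal

-- Cliques, and cutting a decomposition at a bag

module _ {G : Graph n} {l : ℕ} {X : ℕ → Subset n} (d : IsPathDec G ⊤ l X) where

  private
    firstOccurrence : ∀ v → ∃[ k ] (v ∈ X k × (∀ {i} → v ∈ X i → k ≤ i))
    firstOccurrence v = least (λ i → v ∈? X i) (proj₂ (proj₂ (vertices d (∈⊤ {x = v}))))

    first : Fin n → ℕ
    first v = proj₁ (firstOccurrence v)

    first-∈ : ∀ v → v ∈ X (first v)
    first-∈ v = proj₁ (proj₂ (firstOccurrence v))

    first-≤ : ∀ {v i} → v ∈ X i → first v ≤ i
    first-≤ {v} = proj₂ (proj₂ (firstOccurrence v))

    first-≤last : ∀ v → first v ≤ l
    first-≤last v = let _ , i≤l , p = vertices d (∈⊤ {x = v}) in ≤-trans (first-≤ p) i≤l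

  -- Helly property of intervals: the bag at the latest first occurrence contains the clique.
  clique⊆bag : ∀ {K} → (∀ {u v} → u ∈ K → v ∈ K → u ≢ v → Adj G u v) → ∃[ j ] (j ≤ l × K ⊆ X j)
  clique⊆bag {K} clique = j , maxF-lub firstIn firstIn-≤last , K⊆Xj
    where
      firstIn : Fin n → ℕ
      firstIn v with v ∈? K
      ... | yes _ = first v
      ... | no  _ = 0

      firstIn-∈ : ∀ {v} → v ∈ K → firstIn v ≡ first v
      firstIn-∈ {v} v∈ with v ∈? K
      ... | yes _  = refl
      ... | no  v∉ = contradiction v∈ v∉

      firstIn-≤last : ∀ v → firstIn v ≤ l
      firstIn-≤last v with v ∈? K
      ... | yes _ = first-≤last v
      ... | no  _ = z≤n

      j : ℕ
      j = maxF firstIn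

      first≤j : ∀ {u} → u ∈ K → first u ≤ j
      first≤j {u} u∈ = subst (_≤ j) (firstIn-∈ u∈) (maxF-ub firstIn u)

      attained : j ≡ 0 ⊎ ∃[ x ] (x ∈ K × first x ≡ j)
      attained with maxF-attained firstIn
      ... | inj₁ j≡0 = inj₁ j≡0
      ... | inj₂ (x , x≡j) with x ∈? K
      ...   | yes x∈ = inj₂ (x , x∈ , x≡j)
      ...   | no  _  = inj₁ (≡.sym x≡j)

      K⊆Xj : K ⊆ X j
      K⊆Xj {u} u∈ with attained
      ... | inj₁ j≡0 = subst (λ i → u ∈ X i) first≡j (first-∈ u)
        where
          first≡j : first u ≡ j
          first≡j = trans (n≤0⇒n≡0 (subst (first u ≤_) j≡0 (first≤j u∈))) (≡.sym j≡0)
      ... | inj₂ (x , x∈ , x≡j) with u Fin.≟ x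
      ...   | yes refl = subst (λ i → u ∈ X i) x≡j (first-∈ u)
      ...   | no  u≢x  = let i , i≤l , ui , xi = edges d ∈⊤ ∈⊤ (clique u∈ x∈ u≢x) in
                         convex d (first u) j i (first≤j u∈) (subst (_≤ i) x≡j (first-≤ xi)) i≤l
                                (first-∈ u) ui

∣∣∸1-mono : {p q : Subset n} → p ⊆ q → ∣ p ∣ ∸ 1 ≤ ∣ q ∣ ∸ 1
∣∣∸1-mono p⊆q = ∸-monoˡ-≤ 1 (p⊆q⇒∣p∣≤∣q∣ p⊆q)

module _ {G : Graph n} {W : Subset n} {w : ℕ} where

  weaken : ∀ {w′} → w ≤ w′ → Decomposition G W w → Decomposition G W w′
  weaken w≤w′ (decomposition l X d X≤w) = decomposition l X d λ i i≤l → ≤-trans (X≤w i i≤l) w≤w′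

  snoc : ∀ {B} (D : Decomposition G W w) → B ⊆ bags D (last D) → ∃[ D′ ] bags D′ (last D′) ≡ B
  snoc {B} (decomposition l X d X≤w) B⊆Xl =
    decomposition (suc (l + 0)) (append l X λ _ → B)
      (IsPathDec-resp-⊆ W∪B⊆W (x∈p∪q⁺ ∘ inj₁)
        (append-isPathDec d single-isPathDec (λ _ v∈B → B⊆Xl v∈B , v∈B)
                          (λ _ u∈ v∈ → inj₁ (W∪B⊆W u∈ , W∪B⊆W v∈))))
      (append-width X≤w λ _ _ → ≤-trans (∣∣∸1-mono B⊆Xl) (X≤w l ≤-refl)) ,
    append-> 0
    where
      open Append l 0 X (λ _ → B)
      W∪B⊆W : W ∪ B ⊆ W
      W∪B⊆W v∈ = [ (λ v∈W → v∈W) , inside d l ≤-refl ∘ B⊆Xl ]′ (x∈p∪q⁻ _ _ v∈)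

module _ {G : Graph n} {w : ℕ} (D : Decomposition G ⊤ w) {j : ℕ} (j≤l : j ≤ last D) {A : Subset n}
         (N⊆Xj : N G A ⊆ bags D j) (early : ∀ {a} → a ∈ A → ∃[ i ] (i ≤ j × a ∈ bags D i)) where

  private
    X : ℕ → Subset n
    X = bags D

    d : IsPathDec G ⊤ (last D) X
    d = isPathDec D

    ∈∩⁻ : ∀ {i v} → v ∈ X i ∩ N[ G , A ] → v ∈ X i × v ∈ N[ G , A ]
    ∈∩⁻ = x∈p∩q⁻ _ _

    late⇒∈Xj : ∀ {v i} → v ∈ N[ G , A ] → v ∈ X i → j ≤ i → i ≤ last D → v ∈ X j
    late⇒∈Xj v∈ p j≤i i≤l with ∈N[]⁻ G v∈
    ... | inj₁ v∈N = N⊆Xj v∈N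
    ... | inj₂ v∈A = let i′ , i′≤j , p′ = early v∈A in convex d i′ _ _ i′≤j j≤i i≤l p′ p

  prefix-isPathDec : IsPathDec G N[ G , A ] j (λ i → X i ∩ N[ G , A ])
  prefix-isPathDec = record
    { inside   = λ _ _ → proj₂ ∘ ∈∩⁻
    ; vertices = vertex
    ; edges    = edge
    ; convex   = λ i j′ k i≤j′ j′≤k k≤j p q →
        x∈p∩q⁺ (convex d i j′ k i≤j′ j′≤k (≤-trans k≤j j≤l) (proj₁ (∈∩⁻ p)) (proj₁ (∈∩⁻ q)) ,
                proj₂ (∈∩⁻ p))
    }
    where
      vertex : ∀ {v} → v ∈ N[ G , A ] → ∃[ i ] (i ≤ j × v ∈ X i ∩ N[ G , A ])
      vertex v∈ with ∈N[]⁻ G v∈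
      ... | inj₁ v∈N = j , ≤-refl , x∈p∩q⁺ (N⊆Xj v∈N , v∈)
      ... | inj₂ v∈A = let i , i≤j , p = early v∈A in i , i≤j , x∈p∩q⁺ (p , v∈)

      edge : ∀ {u v} → u ∈ N[ G , A ] → v ∈ N[ G , A ] → Adj G u v →
             ∃[ i ] (i ≤ j × u ∈ X i ∩ N[ G , A ] × v ∈ X i ∩ N[ G , A ])
      edge u∈ v∈ uv with edges d ∈⊤ ∈⊤ uv
      ... | i , i≤l , p , q with i ≤? j
      ...   | yes i≤j = i , i≤j , x∈p∩q⁺ (p , u∈) , x∈p∩q⁺ (q , v∈)
      ...   | no  i≰j = j , ≤-refl , x∈p∩q⁺ (late⇒∈Xj u∈ p j≤i i≤l , u∈) , x∈p∩q⁺ (late⇒∈Xj v∈ q j≤i i≤l , v∈)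
        where j≤i = <⇒≤ (≰⇒> i≰j)

  cut : ∃[ D′ ] bags {G = G} {N[ G , A ]} {w} D′ (last D′) ≡ N G A
  cut = snoc (decomposition j _ prefix-isPathDec
               λ i i≤j → ≤-trans (∣∣∸1-mono (proj₁ ∘ ∈∩⁻)) (widthAtMost D i (≤-trans i≤j j≤l)))
             λ v∈N → x∈p∩q⁺ (N⊆Xj v∈N , N⊆N[] G v∈N)

-- Splitting and gluing along S ∪ N(L)

compl-cover⇒clique : {G : Graph n} {C : Subset n} → IsVertexCoverCompl G C →
                     ∀ {u v} → u ∈ ∁ C → v ∈ ∁ C → u ≢ v → Adj G u v
compl-cover⇒clique {G = G} cover {u} {v} u∈S v∈S u≢v with adj G u v in uv
... | true  = refl
... | false with cover u v (u≢v , λ uv′ → contradiction (trans (≡.sym uv) uv′) λ ())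
...   | inj₁ u∈C = contradiction u∈C (x∈∁p⇒x∉p u∈S)
...   | inj₂ v∈C = contradiction v∈C (x∈∁p⇒x∉p v∈S)

module Partition (G : Graph n) (C L : Subset n) (L⊆C : L ⊆ C) where

  R M : Subset n
  R = C ∩ ∁ N[ G , L ]
  M = ∁ C ∪ N G L

  ∈R⁻ : ∀ {v} → v ∈ R → v ∈ C × v ∉ N[ G , L ]
  ∈R⁻ v∈ = let v∈C , v∈∁ = x∈p∩q⁻ _ _ v∈ in v∈C , x∈∁p⇒x∉p v∈∁

  ∈R⁺ : ∀ {v} → v ∈ C → v ∉ N[ G , L ] → v ∈ R
  ∈R⁺ v∈C v∉ = x∈p∩q⁺ (v∈C , x∉p⇒x∈∁p v∉)

  ∈M⁻ : ∀ {v} → v ∈ M → v ∉ C ⊎ v ∈ N G L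
  ∈M⁻ v∈ = [ inj₁ ∘ x∈∁p⇒x∉p , inj₂ ]′ (x∈p∪q⁻ _ _ v∈)

  ∉C⇒∈M : ∀ {v} → v ∉ C → v ∈ M
  ∉C⇒∈M v∉C = x∈p∪q⁺ (inj₁ (x∉p⇒x∈∁p v∉C))

  N⊆M : N G L ⊆ M
  N⊆M v∈N = x∈p∪q⁺ (inj₂ v∈N)

  N[]∩M⊆N : ∀ {v} → v ∈ N[ G , L ] → v ∈ M → v ∈ N G L
  N[]∩M⊆N v∈ v∈M with ∈M⁻ v∈M | ∈N[]⁻ G v∈
  ... | inj₂ v∈N | _        = v∈N
  ... | inj₁ _   | inj₁ v∈N = v∈N
  ... | inj₁ v∉C | inj₂ v∈L = contradiction (L⊆C v∈L) v∉C

  N[R]⊆M : N G R ⊆ M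
  N[R]⊆M {u} u∈N with ∈N⁻ G u∈N | u ∈? C
  ... | _                   | no  u∉C = ∉C⇒∈M u∉C
  ... | u∉R , r , r∈R , ru | yes u∈C with ∈N[]⁻ G (u∈N[L] u∉R u∈C)
    where
      u∈N[L] : u ∉ R → u ∈ C → u ∈ N[ G , L ]
      u∈N[L] u∉R u∈C with u ∈? N[ G , L ]
      ... | yes u∈ = u∈
      ... | no  u∉ = contradiction (∈R⁺ u∈C u∉) u∉R
  ...   | inj₁ u∈N = N⊆M u∈N
  ...   | inj₂ u∈L = contradiction (Adj⇒∈N[] G u∈L (Adj-sym G ru)) (proj₂ (∈R⁻ r∈R))

  M∩R≡∅ : ∀ {v} → v ∈ M → v ∉ R
  M∩R≡∅ v∈M v∈R with ∈M⁻ v∈M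
  ... | inj₁ v∉C = v∉C (proj₁ (∈R⁻ v∈R))
  ... | inj₂ v∈N = proj₂ (∈R⁻ v∈R) (N⊆N[] G v∈N)

  M∪N[R]∖R⊆M : ∀ {v} → v ∈ M ∪ N[ G , R ] → v ∉ R → v ∈ M
  M∪N[R]∖R⊆M v∈ v∉R with x∈p∪q⁻ _ _ v∈
  ... | inj₁ v∈M = v∈M
  ... | inj₂ v∈N[R] = [ N[R]⊆M , (λ v∈R → contradiction v∈R v∉R) ]′ (∈N[]⁻ G v∈N[R])

  ∉L∪R⇒∈M : ∀ {v} → v ∉ L → v ∉ R → v ∈ M
  ∉L∪R⇒∈M {v} v∉L v∉R with v ∈? C | v ∈? N[ G , L ]
  ... | no  v∉C | _        = ∉C⇒∈M v∉C
  ... | yes v∈C | no  v∉   = contradiction (∈R⁺ v∈C v∉) v∉R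
  ... | yes _   | yes v∈   = N⊆M ([ (λ v∈N → v∈N) , (λ v∈L → contradiction v∈L v∉L) ]′ (∈N[]⁻ G v∈))

  ∉L⇒∈M∪N[R] : ∀ {v} → v ∉ L → v ∈ M ∪ N[ G , R ]
  ∉L⇒∈M∪N[R] {v} v∉L with v ∈? R
  ... | yes v∈R = x∈p∪q⁺ (inj₂ (⊆N[] G v∈R))
  ... | no  v∉R = x∈p∪q⁺ (inj₁ (∉L∪R⇒∈M v∉L v∉R))

module LowerBound (G : Graph n) (C : Subset n) (cover : IsVertexCoverCompl G C)
                  {w : ℕ} (D : Decomposition G ⊤ w) where

  private
    X : ℕ → Subset n
    X = bags D

    l : ℕ
    l = last D

    d : IsPathDec G ⊤ l X
    d = isPathDec D

  centre : ∃[ j ] (j ≤ l × ∁ C ⊆ X j)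
  centre = clique⊆bag d (compl-cover⇒clique {G = G} cover)

  j : ℕ
  j = proj₁ centre

  j≤l : j ≤ l
  j≤l = proj₁ (proj₂ centre)

  S⊆Xj : ∁ C ⊆ X j
  S⊆Xj = proj₂ (proj₂ centre)

  Late : Fin n → Set
  Late v = ∃[ i ] (i ≤ l × j ≤ i × v ∈ X i)

  late? : Decidable Late
  late? v = ∃≤? (λ i → j ≤? i ×-dec v ∈? X i) l

  early? : Decidable (λ v → v ∈ C × ¬ Late v)
  early? v = v ∈? C ×-dec ¬? (late? v)

  L : Subset n
  L = ⟦ early? ⟧

  L⊆C : L ⊆ C
  L⊆C = proj₁ ∘ ∈⟦⟧⁻ early?

  open Partition G C L L⊆C

  L-early : ∀ {a i} → a ∈ L → a ∈ X i → i ≤ l → i < j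
  L-early {a} {i} a∈L p i≤l with j ≤? i
  ... | yes j≤i = contradiction (i , i≤l , j≤i , p) (proj₂ (∈⟦⟧⁻ early? a∈L))
  ... | no  j≰i = ≰⇒> j≰i

  late : ∀ {v} → v ∈ C → v ∉ L → Late v
  late {v} v∈C v∉L with late? v
  ... | yes lateV = lateV
  ... | no  ¬late = contradiction (∈⟦⟧⁺ early? (v∈C , ¬late)) v∉L

  N⊆Xj : N G L ⊆ X j
  N⊆Xj {u} u∈N with ∈N⁻ G u∈N | u ∈? C
  ... | _ | no u∉C = S⊆Xj (x∉p⇒x∈∁p u∉C)
  ... | u∉L , a , a∈L , au | yes u∈C =
    let i , i≤l , ai , ui = edges d ∈⊤ ∈⊤ au
        i′ , i′≤l , j≤i′ , ui′ = late u∈C u∉L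
    in convex d i j i′ (<⇒≤ (L-early a∈L ai i≤l)) j≤i′ i′≤l ui ui′

  M⊆Xj : M ⊆ X j
  M⊆Xj v∈M = [ S⊆Xj , N⊆Xj ]′ (x∈p∪q⁻ _ _ v∈M)

  left : ∃[ D′ ] bags {G = G} {N[ G , L ]} {w} D′ (last D′) ≡ N G L
  left = cut D j≤l N⊆Xj λ a∈L →
    let i , i≤l , p = vertices d ∈⊤ in i , <⇒≤ (L-early a∈L p i≤l) , p

  right : ∃[ D′ ] bags {G = G} {N[ G , R ]} {w} D′ (last D′) ≡ N G R
  right = cut (reverse D) (m∸n≤m l j)
    (subst (λ i → N G R ⊆ X i) (≡.sym (m∸[m∸n]≡n j≤l)) (M⊆Xj ∘ N[R]⊆M))
    λ r∈R → let r∈C , r∉N[L] = ∈R⁻ r∈R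
                i , i≤l , j≤i , p = late r∈C (r∉N[L] ∘ ⊆N[] G)
            in l ∸ i , ∸-monoʳ-≤ l j≤i , subst (λ k → _ ∈ X k) (≡.sym (m∸[m∸n]≡n i≤l)) p

  lowerBound : ∃[ L ] (L ⊆ C × ∃[ v ] (Val G C L v × v ≤ w))
  lowerBound =
    let a , a≤w , pwa = Optimal.pwEnd-attained G _ _ (proj₁ left) (inj₂ (proj₂ left))
        b , b≤w , pwb = Optimal.pwEnd-attained G _ _ (proj₁ right) (inj₂ (proj₂ right))
    in L , L⊆C , a ⊔ b ⊔ (∣ M ∣ ∸ 1) , (a , b , pwa , pwb , refl) ,
       ⊔-lub (⊔-lub a≤w b≤w) (≤-trans (∣∣∸1-mono M⊆Xj) (widthAtMost D j j≤l))

module UpperBound (G : Graph n) (C L : Subset n) (L⊆C : L ⊆ C) where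

  open Partition G C L L⊆C

  glue : ∀ {w} (D₁ : Decomposition G N[ G , L ] w) → HasEnd D₁ (N G L) →
         (D₂ : Decomposition G N[ G , R ] w) → HasEnd D₂ (N G R) → ∣ M ∣ ∸ 1 ≤ w →
         Decomposition G ⊤ w
  glue D₁ e₁ D₂ e₂ M≤w with endingWith D₁ e₁ | startingWith D₂ e₂
  ... | decomposition l₁ X₁ d₁ X₁≤w , X₁≡N | decomposition l₂ X₂ d₂ X₂≤w , X₂≡N =
    decomposition _ (append l₁ X₁ Y)
      (IsPathDec-resp-⊆ (λ _ → ∈⊤) everywhere (append-isPathDec d₁ dY seam₁ split₁))
      (append-width X₁≤w (Y.append-width (λ _ _ → M≤w) X₂≤w))
    where
      Y : ℕ → Subset n
      Y = append 0 (λ _ → M) X₂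

      open Append l₁ (suc (0 + l₂)) X₁ Y
      module Y = Append 0 l₂ (λ _ → M) X₂

      dY : IsPathDec G (M ∪ N[ G , R ]) (suc (0 + l₂)) Y
      dY = Y.append-isPathDec single-isPathDec d₂ seam₂ split₂
        where
          seam₂ : ∀ {v} → v ∈ M → v ∈ N[ G , R ] → v ∈ M × v ∈ X₂ 0
          seam₂ v∈M v∈N[R] = v∈M , subst (_ ∈_) (≡.sym X₂≡N)
            ([ (λ v∈N → v∈N) , (λ v∈R → contradiction v∈R (M∩R≡∅ v∈M)) ]′ (∈N[]⁻ G v∈N[R]))

          split₂ : ∀ {u v} → Adj G u v → u ∈ M ∪ N[ G , R ] → v ∈ M ∪ N[ G , R ] →
                   (u ∈ M × v ∈ M) ⊎ (u ∈ N[ G , R ] × v ∈ N[ G , R ])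
          split₂ {u} {v} uv u∈ v∈ with u ∈? R | v ∈? R
          ... | yes u∈R | _       = inj₂ (Adj⇒both∈N[] G uv (inj₁ u∈R))
          ... | no  _   | yes v∈R = inj₂ (Adj⇒both∈N[] G uv (inj₂ v∈R))
          ... | no  u∉R | no  v∉R = inj₁ (M∪N[R]∖R⊆M u∈ u∉R , M∪N[R]∖R⊆M v∈ v∉R)

      seam₁ : ∀ {v} → v ∈ N[ G , L ] → v ∈ M ∪ N[ G , R ] → v ∈ X₁ l₁ × v ∈ Y 0
      seam₁ v∈N[L] v∈ =
        let v∈M = M∪N[R]∖R⊆M v∈ λ v∈R → proj₂ (∈R⁻ v∈R) v∈N[L] in
        subst (_ ∈_) (≡.sym X₁≡N) (N[]∩M⊆N v∈N[L] v∈M) , v∈M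

      split₁ : ∀ {u v} → Adj G u v → u ∈ N[ G , L ] ∪ (M ∪ N[ G , R ]) → v ∈ N[ G , L ] ∪ (M ∪ N[ G , R ]) →
               (u ∈ N[ G , L ] × v ∈ N[ G , L ]) ⊎ (u ∈ M ∪ N[ G , R ] × v ∈ M ∪ N[ G , R ])
      split₁ {u} {v} uv _ _ with u ∈? L | v ∈? L
      ... | yes u∈L | _       = inj₁ (Adj⇒both∈N[] G uv (inj₁ u∈L))
      ... | no  _   | yes v∈L = inj₁ (Adj⇒both∈N[] G uv (inj₂ v∈L))
      ... | no  u∉L | no  v∉L = inj₂ (∉L⇒∈M∪N[R] u∉L , ∉L⇒∈M∪N[R] v∉L)

      everywhere : ⊤ ⊆ N[ G , L ] ∪ (M ∪ N[ G , R ])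
      everywhere {v} _ with v ∈? L
      ... | yes v∈L = x∈p∪q⁺ (inj₁ (⊆N[] G v∈L))
      ... | no  v∉L = x∈p∪q⁺ (inj₂ (∉L⇒∈M∪N[R] v∉L))

  upperBound : ∀ {v} → Val G C L v → ∃[ D ] width {G = G} {⊤} D ≤ v
  upperBound {v} (a , b , ((E₁ , e₁ , E₁≡a) , _) , ((E₂ , e₂ , E₂≡b) , _) , v≡) =
    toPathDec D , toPathDec-width D
    where
      a⊔b≤v : a ⊔ b ≤ v
      a⊔b≤v = ≤-trans (m≤m⊔n (a ⊔ b) _) (≤-reflexive (≡.sym v≡))

      D : Decomposition G ⊤ v
      D = glue (weaken (subst (_≤ v) (≡.sym E₁≡a) (≤-trans (m≤m⊔n a b) a⊔b≤v)) (fromPathDec E₁))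
               (fromPathDec-end E₁ e₁)
               (weaken (subst (_≤ v) (≡.sym E₂≡b) (≤-trans (m≤n⊔m a b) a⊔b≤v)) (fromPathDec E₂))
               (fromPathDec-end E₂ e₂)
               (≤-trans (m≤n⊔m (a ⊔ b) _) (≤-reflexive (≡.sym v≡)))

lemma14 : ∀ {n} (G : Graph n) (C : Subset n) → IsVertexCoverCompl G C →
            ∀ (k : ℕ) → Pw G k ⇔ MinVal G C k
lemma14 G C cover k = mk⇔ pw⇒min min⇒pw
  where
    lower : (D : PathDec G ⊤) → ∃[ L ] (L ⊆ C × ∃[ v ] (Val G C L v × v ≤ width D))
    lower D = LowerBound.lowerBound G C cover (fromPathDec D)

    upper : ∀ {L v} → L ⊆ C → Val G C L v → ∃[ D ] width {G = G} {⊤} D ≤ v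
    upper {L} L⊆C = UpperBound.upperBound G C L L⊆C

    pw⇒min : Pw G k → MinVal G C k
    pw⇒min ((D , D≡k) , optimal) =
      let L , L⊆C , v , val , v≤D = lower D
          D′ , D′≤v = upper L⊆C val
          v≡k = ≤-antisym (subst (v ≤_) D≡k v≤D) (≤-trans (optimal D′) D′≤v)
      in (L , L⊆C , subst (Val G C L) v≡k val) ,
         λ L′ v′ L′⊆C val′ → let D″ , D″≤v′ = upper L′⊆C val′ in ≤-trans (optimal D″) D″≤v′

    min⇒pw : MinVal G C k → Pw G k
    min⇒pw ((L , L⊆C , val) , minimal) =
      let D , D≤k = upper L⊆C val in (D , ≤-antisym D≤k (below D)) , below
      where
        below : ∀ D′ → k ≤ width D′
        below D′ = let L′ , L′⊆C , v′ , val′ , v′≤D′ = lower D′ in ≤-trans (minimal L′ v′ L′⊆C val′) v′≤D′
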